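{- If $r \in \mathbb{Z}_{\ge 0}$ and $\underline{l} \in E'_r \setminus (E_{r,0} \cup E_{r,1})$, then there exists $\underline{m} \in E_{r-1,0} \cup E_{r,2}$ such that $K(\underline{l}) \le K(\underline{m})$.
   Context: The continuants $K_d(X_1,\dotsc,X_d)$ are defined by $K_0 = 1$, $K_1(X_1) = X_1$, and $K_d(X_1,\dotsc,X_d) = X_d K_{d-1}(X_1,\dotsc,X_{d-1}) + K_{d-2}(X_1,\dotsc,X_{d-2})$ for $d\ge 2$; for $\underline{l}=(l_1,\dotsc,l_d)$ write $K(\underline{l}) = K_d(l_1,\dotsc,l_d)$. For $r\in\mathbb{Z}$, $E_r$ (resp. $E'_r$) is the set of all tuples $(l_1,\dotsc,l_d)$ with $d\in\mathbb{Z}_{\ge 1}$, $l_1,\dotsc,l_d\in\mathbb{Z}_{\ge 1}$, $l_1=l_d=1$ and $l_1+\dotsb+l_d = r+1$ (resp. $\le r+1$). Let $h(l_1,\dotsc,l_d) = l_1+\dotsb+l_d - d$. For $a\in\mathbb{Z}_{\ge 0}$, $E_{r,a} = \{\underline{l}\in E_r;\ h(\underline{l}) = a\}$. -}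

module Defs where

open import Data.Nat using (ℕ; zero; suc; _+_; _*_; _∸_; _≤_)
open import Data.List using (List; []; _∷_; length; head; last)
open import Data.Nat.ListAction using (sum)
open import Data.List.Relation.Unary.All using (All)
open import Data.Maybe using (just)
open import Data.Product using (_×_; _,_; proj₂)
open import Relation.Binary.PropositionalEquality using (_≡_)

-- Continuants computed left to right: given the pair (K_{d-2}, K_{d-1})
-- for the prefix processed so far, step with the next entry X_d.
contStep : ℕ × ℕ → List ℕ → ℕ × ℕ
contStep p [] = p
contStep (a , b) (x ∷ xs) = contStep (b , x * b + a) xs

-- K(l_1,...,l_d) = K_d(l_1,...,l_d), with K_{-1} = 0, K_0 = 1
-- (K_1 = X_1 * 1 + 0 = X_1, and K_d = X_d K_{d-1} + K_{d-2}).
K : List ℕ → ℕ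
K l = proj₂ (contStep (0 , 1) l)

h : List ℕ → ℕ
h l = sum l ∸ length l

-- Tuples (l_1,...,l_d) with d ≥ 1, all l_i ≥ 1, l_1 = l_d = 1.
-- (head/last return 'just' only for nonempty lists, so d ≥ 1 is implied.)
Admissible : List ℕ → Set
Admissible l = All (1 ≤_) l × head l ≡ just 1 × last l ≡ just 1

-- InEsum n l  means  means  l ∈ E_{n-1},
-- i.e. sum l = n.  This avoids natural-number subtraction for E_{r-1}.
InEsum : ℕ → List ℕ → Set
InEsum n l = Admissible l × sum l ≡ n

InE : ℕ → List ℕ → Set
InE r l = InEsum (suc r) l

InE' : ℕ → List ℕ → Set
InE' r l = Admissible l × sum l ≤ suc r

InEa : ℕ → ℕ → List ℕ → Set
InEa r a l = InE r l × h l ≡ a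

-- Splitting an entry x ≥ 2 into (x - 1, 1) turns (K′, x K′ + K″) into
-- ((x - 1) K′ + K″, x K′ + K″), and all later continuants are monotone in
-- this pair, so K does not decrease, while the sum is kept and h drops by one.
-- Hence h can be lowered to any smaller value without decreasing K. If l has
-- sum r + 1 and h(l) ≥ 2, lower h to 2; otherwise sum l ≤ r, and after
-- prepending ones to reach sum r (which does not decrease K either) lower h to 0.
module Submission where

open import Defs
open import Data.Nat using (ℕ; _≤_)
open import Data.List using (List)
open import Data.Product using (Σ; _×_)
open import Data.Sum using (_⊎_)
open import Relation.Nullary using (¬_)
open import Relation.Binary.PropositionalEquality using (_≡_)

open import Data.Nat using (zero; suc; _+_; _*_; _∸_; _<_; z≤n; s≤s)
open import Data.Nat.Properties
open import Data.Nat.ListAction using (sum)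
open import Data.List using ([]; _∷_; _++_; length; head; last; replicate)
open import Data.List.Relation.Unary.All using (All; _∷_)
open import Data.Maybe using (just)
open import Data.Product using (_,_; proj₁; proj₂)
open import Data.Sum using (inj₁; inj₂)
open import Relation.Nullary using (contradiction)
open import Relation.Binary.PropositionalEquality
  using (refl; sym; trans; cong; cong₂; module ≡-Reasoning)
open import Data.Nat.Solver using (module +-*-Solver)
open +-*-Solver using (solve; _:+_; _:*_; _:=_; con)

_≤₂_ : ℕ × ℕ → ℕ × ℕ → Set
(a , b) ≤₂ (c , d) = a ≤ c × b ≤ d

contStep-mono : ∀ xs {a b c d} → a ≤ c → b ≤ d → contStep (a , b) xs ≤₂ contStep (c , d) xs
contStep-mono []       a≤c b≤d = a≤c , b≤d
contStep-mono (x ∷ xs) a≤c b≤d = contStep-mono xs b≤d (+-mono-≤ (*-monoʳ-≤ x b≤d) a≤c)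

length≤sum : ∀ {xs} → All (1 ≤_) xs → length xs ≤ sum xs
length≤sum All.[]       = z≤n
length≤sum (1≤x ∷ 1≤xs) = +-mono-≤ 1≤x (length≤sum 1≤xs)

2≤-if-≢0,1 : ∀ n → ¬ (n ≡ 0 ⊎ n ≡ 1) → 2 ≤ n
2≤-if-≢0,1 zero          n≢0,1 = contradiction (inj₁ refl) n≢0,1
2≤-if-≢0,1 (suc zero)    n≢0,1 = contradiction (inj₂ refl) n≢0,1
2≤-if-≢0,1 (suc (suc n)) _     = s≤s (s≤s z≤n)

split : List ℕ → List ℕ
split []                 = []
split (suc (suc n) ∷ xs) = suc n ∷ 1 ∷ xs
split (x ∷ xs)           = x ∷ split xs

sum-split : ∀ xs → sum (split xs) ≡ sum xs
sum-split []                 = refl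
sum-split (zero ∷ xs)        = sum-split xs
sum-split (suc zero ∷ xs)    = cong suc (sum-split xs)
sum-split (suc (suc n) ∷ xs) = cong suc (+-suc n (sum xs))

length-split : ∀ {xs} → All (1 ≤_) xs → length xs < sum xs → length (split xs) ≡ suc (length xs)
length-split {suc zero ∷ xs}    (_ ∷ 1≤xs) (s≤s len<sum) = cong suc (length-split 1≤xs len<sum)
length-split {suc (suc n) ∷ xs} _          _             = refl

all-split : ∀ {xs} → All (1 ≤_) xs → All (1 ≤_) (split xs)
all-split All.[]                          = All.[]
all-split {suc zero ∷ _}    (1≤x ∷ 1≤xs) = 1≤x ∷ all-split 1≤xs
all-split {suc (suc n) ∷ _} (_ ∷ 1≤xs)   = s≤s z≤n ∷ s≤s z≤n ∷ 1≤xs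

admissible-split : ∀ {xs} → Admissible xs → Admissible (split xs)
admissible-split {xs} (1≤xs , head≡1 , last≡1) = all-split 1≤xs , head-split xs head≡1 , last-split xs last≡1
  where
  head-split : ∀ xs → head xs ≡ just 1 → head (split xs) ≡ just 1
  head-split (suc zero ∷ _) refl = refl

  last-∷-split : ∀ x y ys → last (x ∷ split (y ∷ ys)) ≡ last (split (y ∷ ys))
  last-∷-split x zero          ys = refl
  last-∷-split x (suc zero)    ys = refl
  last-∷-split x (suc (suc n)) ys = refl

  last-split : ∀ xs → last xs ≡ just 1 → last (split xs) ≡ just 1
  last-split (suc zero ∷ [])        refl    = refl
  last-split (zero ∷ y ∷ ys)        last≡1 = trans (last-∷-split 0 y ys) (last-split (y ∷ ys) last≡1)
  last-split (suc zero ∷ y ∷ ys)    last≡1 = trans (last-∷-split 1 y ys) (last-split (y ∷ ys) last≡1)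
  last-split (suc (suc n) ∷ y ∷ ys) last≡1 = last≡1

contStep-split : ∀ xs a b → contStep (a , b) xs ≤₂ contStep (a , b) (split xs)
contStep-split []                 a b = ≤-refl , ≤-refl
contStep-split (zero ∷ xs)        a b = contStep-split xs b (0 * b + a)
contStep-split (suc zero ∷ xs)    a b = contStep-split xs b (1 * b + a)
contStep-split (suc (suc n) ∷ xs) a b = contStep-mono xs b≤ (≤-reflexive split-point)
  where
  b≤ : b ≤ suc n * b + a
  b≤ = ≤-trans (m≤m+n b (n * b)) (m≤m+n (suc n * b) a)

  split-point : suc (suc n) * b + a ≡ 1 * (suc n * b + a) + b
  split-point = solve 3 (λ n b a → (con 2 :+ n) :* b :+ a := con 1 :* ((con 1 :+ n) :* b :+ a) :+ b) refl n b a

K-split : ∀ xs → K xs ≤ K (split xs)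
K-split xs = proj₂ (contStep-split xs 0 1)

splitⁿ : ℕ → List ℕ → List ℕ
splitⁿ zero    xs = xs
splitⁿ (suc k) xs = splitⁿ k (split xs)

sum-splitⁿ : ∀ k xs → sum (splitⁿ k xs) ≡ sum xs
sum-splitⁿ zero    xs = refl
sum-splitⁿ (suc k) xs = trans (sum-splitⁿ k (split xs)) (sum-split xs)

admissible-splitⁿ : ∀ k {xs} → Admissible xs → Admissible (splitⁿ k xs)
admissible-splitⁿ zero    adm = adm
admissible-splitⁿ (suc k) adm = admissible-splitⁿ k (admissible-split adm)

K-splitⁿ : ∀ k xs → K xs ≤ K (splitⁿ k xs)
K-splitⁿ zero    xs = ≤-refl
K-splitⁿ (suc k) xs = ≤-trans (K-split xs) (K-splitⁿ k (split xs))

length-splitⁿ : ∀ k {xs} → All (1 ≤_) xs → length xs + k ≤ sum xs →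
                length (splitⁿ k xs) ≡ length xs + k
length-splitⁿ zero    _ _ = sym (+-identityʳ _)
length-splitⁿ (suc k) {xs} 1≤xs ≤sum = begin
  length (splitⁿ k (split xs)) ≡⟨ length-splitⁿ k (all-split 1≤xs) ≤sum′ ⟩
  length (split xs) + k        ≡⟨ cong (_+ k) length-split₁ ⟩
  suc (length xs) + k          ≡⟨ +-suc (length xs) k ⟨
  length xs + suc k            ∎
  where
  open ≡-Reasoning
  length-split₁ : length (split xs) ≡ suc (length xs)
  length-split₁ = length-split 1≤xs (≤-trans (s≤s (m≤m+n (length xs) k)) (≤-trans (≤-reflexive (sym (+-suc (length xs) k))) ≤sum))
  ≤sum′ : length (split xs) + k ≤ sum (split xs)
  ≤sum′ = ≤-trans (≤-reflexive (trans (cong (_+ k) length-split₁) (sym (+-suc (length xs) k))))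
                  (≤-trans ≤sum (≤-reflexive (sym (sum-split xs))))

h-splitⁿ : ∀ k {xs} → All (1 ≤_) xs → k ≤ h xs → h (splitⁿ k xs) ≡ h xs ∸ k
h-splitⁿ k {xs} 1≤xs k≤h = begin
  sum (splitⁿ k xs) ∸ length (splitⁿ k xs) ≡⟨ cong₂ _∸_ (sum-splitⁿ k xs) (length-splitⁿ k 1≤xs ≤sum) ⟩
  sum xs ∸ (length xs + k)                 ≡⟨ ∸-+-assoc (sum xs) (length xs) k ⟨
  h xs ∸ k                                 ∎
  where
  open ≡-Reasoning
  ≤sum : length xs + k ≤ sum xs
  ≤sum = ≤-trans (+-monoʳ-≤ (length xs) k≤h) (≤-reflexive (m+[n∸m]≡n (length≤sum 1≤xs)))

lower-h : ∀ a {xs} → Admissible xs → a ≤ h xs →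
          Σ (List ℕ) λ m → Admissible m × sum m ≡ sum xs × h m ≡ a × K xs ≤ K m
lower-h a {xs} adm a≤h =
  splitⁿ k xs , admissible-splitⁿ k adm , sum-splitⁿ k xs ,
  trans (h-splitⁿ k (proj₁ adm) (m∸n≤m (h xs) a)) (m∸[m∸n]≡n a≤h) , K-splitⁿ k xs
  where
  k : ℕ
  k = h xs ∸ a

pad : ℕ → List ℕ → List ℕ
pad j xs = replicate j 1 ++ xs

sum-pad : ∀ j xs → sum (pad j xs) ≡ j + sum xs
sum-pad zero    xs = refl
sum-pad (suc j) xs = cong suc (sum-pad j xs)

admissible-pad : ∀ j {xs} → Admissible xs → Admissible (pad j xs)
admissible-pad zero    adm = adm
admissible-pad (suc j) adm = admissible-1∷ (admissible-pad j adm)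
  where
  admissible-1∷ : ∀ {xs} → Admissible xs → Admissible (1 ∷ xs)
  admissible-1∷ {_ ∷ _} (1≤xs , _ , last≡1) = s≤s z≤n ∷ 1≤xs , refl , last≡1

K-pad : ∀ j xs → K xs ≤ K (pad j xs)
K-pad zero    xs = ≤-refl
K-pad (suc j) xs = ≤-trans (K-pad j xs) (proj₂ (contStep-mono (pad j xs) z≤n ≤-refl))

proposition4p2 : (r : ℕ) (l : List ℕ) → InE' r l → ¬ (InEa r 0 l ⊎ InEa r 1 l) →
    Σ (List ℕ) (λ m → ((InEsum r m × h m ≡ 0) ⊎ InEa r 2 m) × K l ≤ K m)
proposition4p2 r l (adm , sum≤) l∉E₀∪E₁ with m≤n⇒m<n∨m≡n sum≤
... | inj₂ sum≡ =
  let m , adm′ , sum-m , h≡2 , K≤ = lower-h 2 adm (2≤-if-≢0,1 (h l) h≢0,1)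
  in  m , inj₂ ((adm′ , trans sum-m sum≡) , h≡2) , K≤
  where
  h≢0,1 : ¬ (h l ≡ 0 ⊎ h l ≡ 1)
  h≢0,1 (inj₁ h≡0) = l∉E₀∪E₁ (inj₁ ((adm , sum≡) , h≡0))
  h≢0,1 (inj₂ h≡1) = l∉E₀∪E₁ (inj₂ ((adm , sum≡) , h≡1))
... | inj₁ (s≤s sum≤r) =
  let m , adm′ , sum-m , h≡0 , K≤ = lower-h 0 (admissible-pad j adm) z≤n
  in  m , inj₁ ((adm′ , trans sum-m (trans (sum-pad j l) (m∸n+n≡m sum≤r))) , h≡0) ,
      ≤-trans (K-pad j l) K≤
  where
  j : ℕ
  j = r ∸ sum l
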